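{- If $\rho_1,\rho_2\in S$ and $x_0\in U(\rho_1)\cap U(\rho_2)$, then there is $\rho\in S$ with $x_0\in U(\rho)\subseteq U(\rho_1)\cap U(\rho_2)$. Consequently, the family $\{U(\rho):\rho\in S\}$ is a countable basis of a topology on $H$.
   Context: $2^\omega$ carries coordinatewise addition mod 2, written $+$; the same $+$ denotes coordinatewise addition mod 2 of 0-1 sequences with the same domain. For sequences, $s\vartriangleleft t$ means $t$ properly extends $s$. Fix integers $0=n_0<n_1<n_2<\cdots$ and sets $C_i\subseteq 2^{[n_i,n_{i+1})}$ ($i\in\omega$) such that for every $i$ and all $s_0,\dots,s_{n_i}\in 2^{[n_i,n_{i+1})}$ both $\bigcap_{k\le n_i}(C_i+s_k)$ and $\bigcap_{k\le n_i}((2^{[n_i,n_{i+1})}\setminus C_i)+s_k)$ are nonempty. Let $H=\{x\in2^\omega: x\upharpoonright[n_i,n_{i+1})\in C_i\text{ for all }i\}$. Fix a sequence $\langle P_m:m\in\omega\rangle$ of nonempty perfect subsets of $2^\omega$ and let $T^*_m=\{z\upharpoonright k: z\in P_m+P_m,\ k\in\omega\}$, where $P_m+P_m=\{x+y:x,y\in P_m\}$. A tree mapping with domain $n\ge 1$ consists of a tree ordering $\prec$ on $\{0,\dots,n-1\}$ (a partial order in which the predecessors of each element are linearly ordered) such that $k\prec\ell$ implies $k<\ell$, together with a function $\pi$ into $\omega$ defined exactly on the pairs $(k,\ell)$ such that $k$ is the immediate $\prec$-predecessor of $\ell$. A finite sequence $s$ is acceptable if $\mathrm{dom}(s)=n_i$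 for some $i$ and $s\upharpoonright[n_j,n_{j+1})\in C_j$ for all $j<i$. $S$ is the set of all tuples $\rho=\langle\pi,s_0,\dots,s_{n-1}\rangle$ with $n\ge1$, $\pi$ a tree mapping with domain $n$, all $s_k$ acceptable with a common domain $n_i$ where $n_i\ge n$, and $s_k+s_\ell\in T^*_{\pi(k,\ell)}$ whenever $\pi(k,\ell)$ is defined; write $n(\rho)=n$, $i(\rho)=i$. For such $\rho$, $U(\rho)$ is the set of all $x_0\in H$ for which there exist $x_1,\dots,x_{n-1}\in H$ with $s_k\vartriangleleft x_k$ for all $k<n$ and $\langle\pi,x_0\upharpoonright n_j,\dots,x_{n-1}\upharpoonright n_j\rangle\in S$ for every $j>i(\rho)$. -}

module Defs where

open import Data.Nat using (ℕ; zero; suc; _+_; _∸_; _<_; _≤_)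
open import Data.Bool using (Bool; _xor_; T)
open import Data.Fin using (Fin; toℕ) renaming (zero to fzero; suc to fsuc)
open import Data.Vec using (Vec; tabulate; zipWith)
open import Data.Product using (Σ; ∃; _×_; proj₁)
open import Data.Sum using (_⊎_)
open import Relation.Binary.PropositionalEquality using (_≡_)
open import Relation.Nullary using (¬_)

Cantor : Set
Cantor = ℕ → Bool

_⊕_ : Cantor → Cantor → Cantor
(x ⊕ y) k = x k xor y k

-- A finite sequence with domain d is represented by any total function
-- whose values below d are the sequence; all notions below only look
-- at the values below the relevant domain.
AgreeBelow : ℕ → Cantor → Cantor → Set
AgreeBelow d s t = ∀ k → k < d → s k ≡ t k

Closed : (Cantor → Set) → Set
Closed A = ∀ x → (∀ d → ∃ λ y → A y × AgreeBelow d x y) → A x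

Perfect : (Cantor → Set) → Set
Perfect A =
  (∃ λ x → A x) × Closed A ×
  (∀ x → A x → ∀ d → ∃ λ y → A y × AgreeBelow d x y × ∃ λ j → ¬ (y j ≡ x j))

SumSet : (Cantor → Set) → Cantor → Set
SumSet A z = ∃ λ x → ∃ λ y → A x × A y × (∀ k → z k ≡ x k xor y k)

-- Blocks: 2^[n_i , n_{i+1}) is represented as Vec Bool (n_{i+1} ∸ n_i),
-- position j of the vector standing for coordinate n_i + j.
len : (ℕ → ℕ) → ℕ → ℕ
len ns i = ns (suc i) ∸ ns i

Block : (ℕ → ℕ) → ℕ → Set
Block ns i = Vec Bool (len ns i)

block : (ns : ℕ → ℕ) → Cantor → (i : ℕ) → Block ns i
block ns x i = tabulate λ j → x (ns i + toℕ j)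

_⊕ᵥ_ : ∀ {m} → Vec Bool m → Vec Bool m → Vec Bool m
u ⊕ᵥ v = zipWith _xor_ u v

InTranslate : ∀ {m} → (Vec Bool m → Set) → Vec Bool m → Vec Bool m → Set
InTranslate A s t = ∃ λ c → A c × (t ≡ c ⊕ᵥ s)

CHyp : (ns : ℕ → ℕ) → ((i : ℕ) → Block ns i → Set) → Set
CHyp ns C = ∀ i (s : Fin (suc (ns i)) → Block ns i) →
  (∃ λ t → ∀ k → InTranslate (C i) (s k) t) ×
  (∃ λ t → ∀ k → InTranslate (λ c → ¬ C i c) (s k) t)

IsTreeOrd : ∀ {n} → (Fin n → Fin n → Bool) → Set
IsTreeOrd {n} R =
  (∀ k l → T (R k l) → toℕ k < toℕ l) ×
  (∀ k l m → T (R k l) → T (R l m) → T (R k m)) ×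
  (∀ k k' l → T (R k l) → T (R k' l) → T (R k k') ⊎ k ≡ k' ⊎ T (R k' k))

ImmPred : ∀ {n} → (Fin n → Fin n → Bool) → Fin n → Fin n → Set
ImmPred R k l = T (R k l) × (∀ m → T (R k m) → ¬ T (R m l))

-- Raw tuples ⟨π, s_0, …, s_{n-1}⟩ with n = suc m, the tree order ≺,
-- and the common level i (domain n_i).  π is total but only its values on
-- immediate-predecessor pairs are ever used.
record Tuple : Set where
  field
    m    : ℕ
    prec : Fin (suc m) → Fin (suc m) → Bool
    π    : Fin (suc m) → Fin (suc m) → ℕ
    i    : ℕ
    s    : Fin (suc m) → Cantor

module Setup (ns : ℕ → ℕ) (C : (i : ℕ) → Block ns i → Set)
             (P : ℕ → Cantor → Set) where

  TStar : ℕ → Cantor → ℕ → Set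
  TStar m t d = ∃ λ z → SumSet (P m) z × AgreeBelow d t z

  InH : Cantor → Set
  InH x = ∀ i → C i (block ns x i)

  Acceptable : ℕ → Cantor → Set
  Acceptable i s = ∀ j → j < i → C j (block ns s j)

  InS : Tuple → Set
  InS ρ =
    IsTreeOrd prec × suc m ≤ ns i × (∀ k → Acceptable i (s k)) ×
    (∀ k l → ImmPred prec k l → TStar (π k l) (s k ⊕ s l) (ns i))
    where open Tuple ρ

  full : ∀ {m} → Cantor → (Fin m → Cantor) → Fin (suc m) → Cantor
  full x0 xs fzero = x0
  full x0 xs (fsuc k) = xs k

  U : Tuple → Cantor → Set
  U ρ x0 = InH x0 × ∃ λ (xs : Fin m → Cantor) →
      (∀ k → InH (full x0 xs k)) ×
      (∀ k → AgreeBelow (ns i) (s k) (full x0 xs k)) ×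
      (∀ j → i < j → InS (record { m = m ; prec = prec ; π = π ; i = j ; s = full x0 xs }))
    where open Tuple ρ

  SetEq : (Cantor → Set) → (Cantor → Set) → Set
  SetEq A B = ∀ x → (A x → B x) × (B x → A x)

-- Given x₀ ∈ U(ρ₁) ∩ U(ρ₂), hang the tree of ρ₂ on the root of the
-- tree of ρ₁ (both roots carry x₀) and take as ρ the glued tree at a level I
-- beyond i(ρ₁), i(ρ₂) with n_I larger than the number of nodes, with the
-- witnesses of x₀ as its sequences.  Then ρ ∈ S and x₀ ∈ U(ρ).  A point
-- y ∈ U(ρ) restricts along the two halves of the glued tree to witnesses for
-- ρ₁ and ρ₂ at all levels beyond I; at the levels up to I these witnesses agree
-- below n_I with those of x₀, so they inherit membership in S from them.
-- Every x ∈ H lies in U of a one-node tuple, and U(ρ) depends only on the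
-- finite data m, i, ≺, π and the s_k ↾ n_i, which are coded injectively by a
-- natural number.  None of the hypotheses on n₀, the C_i or the P_m is needed.

module Submission where

open import Defs
open import Data.Nat using (ℕ; suc; _<_)
open import Data.Product using (Σ; _×_; proj₁)
open import Relation.Binary.PropositionalEquality using (_≡_)

open import Data.Bool using (Bool; true; false; T; _xor_)
open import Data.Empty using (⊥-elim)
open import Data.Fin using (Fin; toℕ; fromℕ<; splitAt; join) renaming (zero to fzero; suc to fsuc)
open import Data.Fin.Properties
  using (toℕ<n; toℕ-fromℕ<; toℕ-↑ˡ; toℕ-↑ʳ; splitAt-join; join-splitAt; injective⇒≤)
open import Data.Nat using (zero; _+_; _≤_; _≤′_; ≤′-refl; ≤′-step; z≤n; s≤s; _≤?_)
import Data.Nat.Properties as ℕ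
open import Data.Nat.Binary using (ℕᵇ; 2[1+_]; 1+[2_])
import Data.Nat.Binary as ℕᵇ
open import Data.Nat.Binary.Properties using (2[1+_]-injective; 1+[2_]-injective; toℕ-injective)
open import Data.Product using (_,_; proj₂; ∃)
open import Data.Sum using (_⊎_; inj₁; inj₂; [_,_]; [_,_]′)
import Data.Sum as Sum
open import Data.Sum.Properties using (inj₁-injective)
open import Data.Vec.Properties using (tabulate-cong)
open import Function using (_∘_; id)
open import Relation.Binary.PropositionalEquality
  using (refl; sym; trans; cong; cong₂; subst; subst₂)
open import Relation.Nullary using (¬_; yes; no)

-- Bijective binary numerals are words in the digits 1+[2_] and 2[1+_]; a ∷ℕ x
-- writes a in unary (a digits 2[1+_] closed by a digit 1+[2_]) in front of x.
infixr 5 _∷ℕ_ _∷𝔹_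

_∷ℕ_ : ℕ → ℕᵇ → ℕᵇ
zero  ∷ℕ x = 1+[2 x ]
suc a ∷ℕ x = 2[1+ a ∷ℕ x ]

∷ℕ-injective : ∀ {a b x y} → a ∷ℕ x ≡ b ∷ℕ y → a ≡ b × x ≡ y
∷ℕ-injective {zero}  {zero}  e = refl , 1+[2_]-injective e
∷ℕ-injective {zero}  {suc b} ()
∷ℕ-injective {suc a} {zero}  ()
∷ℕ-injective {suc a} {suc b} e with ∷ℕ-injective {a} {b} (2[1+_]-injective e)
... | refl , x≡y = refl , x≡y

_∷𝔹_ : Bool → ℕᵇ → ℕᵇ
false ∷𝔹 x = 1+[2 x ]
true  ∷𝔹 x = 2[1+ x ]

∷𝔹-injective : ∀ {a b x y} → a ∷𝔹 x ≡ b ∷𝔹 y → a ≡ b × x ≡ y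
∷𝔹-injective {false} {false} e = refl , 1+[2_]-injective e
∷𝔹-injective {false} {true}  ()
∷𝔹-injective {true}  {false} ()
∷𝔹-injective {true}  {true}  e = refl , 2[1+_]-injective e

encodeFin : ∀ n → (Fin n → ℕᵇ → ℕᵇ) → ℕᵇ → ℕᵇ
encodeFin zero    c x = x
encodeFin (suc n) c x = c fzero (encodeFin n (c ∘ fsuc) x)

encodeFin-injective : ∀ n {c c' : Fin n → ℕᵇ → ℕᵇ} (Q : Fin n → Set) →
  (∀ k {x y} → c k x ≡ c' k y → Q k × x ≡ y) →
  ∀ {x y} → encodeFin n c x ≡ encodeFin n c' y → (∀ k → Q k) × x ≡ y
encodeFin-injective zero    Q decode e = (λ ()) , e
encodeFin-injective (suc n) Q decode e with decode fzero e
... | q , e′ with encodeFin-injective n (Q ∘ fsuc) (decode ∘ fsuc) e′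
...   | qs , x≡y = (λ { fzero → q ; (fsuc k) → qs k }) , x≡y

AgreeBelow-weaken : ∀ {d d' u v} → d ≤ d' → AgreeBelow d' u v → AgreeBelow d u v
AgreeBelow-weaken d≤d' u≈v k k<d = u≈v k (ℕ.<-≤-trans k<d d≤d')

AgreeBelow-sym : ∀ {d u v} → AgreeBelow d u v → AgreeBelow d v u
AgreeBelow-sym u≈v k k<d = sym (u≈v k k<d)

AgreeBelow-trans : ∀ {d u v w} → AgreeBelow d u v → AgreeBelow d v w → AgreeBelow d u w
AgreeBelow-trans u≈v v≈w k k<d = trans (u≈v k k<d) (v≈w k k<d)

≡⇒AgreeBelow : ∀ {d u v} → u ≡ v → AgreeBelow d u v
≡⇒AgreeBelow refl _ _ = refl

AgreeBelow-fromFin : ∀ {d u v} → (∀ (t : Fin d) → u (toℕ t) ≡ v (toℕ t)) → AgreeBelow d u v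
AgreeBelow-fromFin {u = u} {v} u≗v k k<d =
  subst (λ n → u n ≡ v n) (toℕ-fromℕ< k<d) (u≗v (fromℕ< k<d))

AgreeBelow-⊕ : ∀ {d u u' v v'} → AgreeBelow d u u' → AgreeBelow d v v' →
               AgreeBelow d (u ⊕ v) (u' ⊕ v')
AgreeBelow-⊕ u≈u' v≈v' k k<d = cong₂ _xor_ (u≈u' k k<d) (v≈v' k k<d)

Order : ℕ → Set
Order n = Fin n → Fin n → Bool

Labels : ℕ → Set
Labels n = Fin n → Fin n → ℕ

module TreeOrd {m} {R : Order (suc m)} (tree : IsTreeOrd R) where

  ≺-irrefl : ∀ k → ¬ T (R k k)
  ≺-irrefl k k≺k = ℕ.<-irrefl refl (proj₁ tree k k k≺k)

  ≺-fzero : ∀ k → ¬ T (R k fzero)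
  ≺-fzero k k≺0 = ℕ.n≮0 (proj₁ tree k fzero k≺0)

record TreeEmbedding {m' m} (R' : Order (suc m')) (π' : Labels (suc m'))
                     (R : Order (suc m)) (π : Labels (suc m)) : Set where
  field
    embed : Fin (suc m') → Fin (suc m)
    embed-fzero : embed fzero ≡ fzero
    embed-injective : ∀ {a b} → embed a ≡ embed b → a ≡ b
    embed-reflects-< : ∀ {a b} → toℕ (embed a) < toℕ (embed b) → toℕ a < toℕ b
    ≺-preserved : ∀ {a b} → T (R' a b) → T (R (embed a) (embed b))
    ≺-reflected : ∀ {a b} → T (R (embed a) (embed b)) → T (R' a b)
    immediate-preserved : ∀ {a b} → ImmPred R' a b → ImmPred R (embed a) (embed b)
    label-preserved : ∀ {a b} → ImmPred R' a b → π' a b ≡ π (embed a) (embed b)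

isTreeOrd-pullback : ∀ {m' m} {R' : Order (suc m')} {π'} {R : Order (suc m)} {π} →
  TreeEmbedding R' π' R π → IsTreeOrd R → IsTreeOrd R'
isTreeOrd-pullback E (ordered , transitive , linear) =
  (λ a b a≺b → embed-reflects-< (ordered _ _ (≺-preserved a≺b))) ,
  (λ a b c a≺b b≺c → ≺-reflected (transitive _ _ _ (≺-preserved a≺b) (≺-preserved b≺c))) ,
  λ a a' b a≺b a'≺b →
    Sum.map ≺-reflected (Sum.map embed-injective ≺-reflected)
      (linear _ _ _ (≺-preserved a≺b) (≺-preserved a'≺b))
  where open TreeEmbedding E

≗-embedding : ∀ {m} {R R' : Order (suc m)} {π π' : Labels (suc m)} →
  (∀ a b → R a b ≡ R' a b) → (∀ a b → π a b ≡ π' a b) → TreeEmbedding R' π' R π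
≗-embedding {R = R} {R'} R≗R' π≗π' = record
  { embed = id
  ; embed-fzero = refl
  ; embed-injective = id
  ; embed-reflects-< = id
  ; ≺-preserved = to
  ; ≺-reflected = from
  ; immediate-preserved = λ (a≺b , none) →
      to a≺b , λ c a≺c c≺b → none c (from a≺c) (from c≺b)
  ; label-preserved = λ {a} {b} _ → sym (π≗π' a b)
  }
  where
    to : ∀ {a b} → T (R' a b) → T (R a b)
    to {a} {b} = subst T (sym (R≗R' a b))
    from : ∀ {a b} → T (R a b) → T (R' a b)
    from {a} {b} = subst T (R≗R' a b)

-- The tree R₂ is hung on the root of the tree R₁: the nodes are those of R₁
-- followed by the non-root nodes of R₂, and fzero is the common root.
module Merge {m₁ m₂} (R₁ : Order (suc m₁)) (R₂ : Order (suc m₂))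
             (π₁ : Labels (suc m₁)) (π₂ : Labels (suc m₂)) where

  Node : Set
  Node = Fin (suc m₁) ⊎ Fin m₂

  right : Fin (suc m₂) → Node
  right fzero    = inj₁ fzero
  right (fsuc l) = inj₂ l

  _≺_ : Node → Node → Bool
  inj₁ k        ≺ inj₁ l = R₁ k l
  inj₁ fzero    ≺ inj₂ l = R₂ fzero (fsuc l)
  inj₁ (fsuc k) ≺ inj₂ l = false
  inj₂ k        ≺ inj₁ l = false
  inj₂ k        ≺ inj₂ l = R₂ (fsuc k) (fsuc l)

  label : Node → Node → ℕ
  label (inj₁ k) (inj₁ l) = π₁ k l
  label (inj₁ k) (inj₂ l) = π₂ fzero (fsuc l)
  label (inj₂ k) (inj₁ l) = 0  -- never an edge
  label (inj₂ k) (inj₂ l) = π₂ (fsuc k) (fsuc l)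

  rank : Node → ℕ
  rank (inj₁ k) = toℕ k
  rank (inj₂ l) = suc (m₁ + toℕ l)

  ImmNode : Node → Node → Set
  ImmNode x y = T (x ≺ y) × (∀ z → T (x ≺ z) → ¬ T (z ≺ y))

  record Embeds {m} (R : Order (suc m)) (π : Labels (suc m)) (f : Fin (suc m) → Node) : Set where
    field
      root : f fzero ≡ inj₁ fzero
      injective : ∀ {a b} → f a ≡ f b → a ≡ b
      ≺-preserved : ∀ {a b} → T (R a b) → T (f a ≺ f b)
      ≺-reflected : ∀ {a b} → T (f a ≺ f b) → T (R a b)
      downward-closed : ∀ {x b} → T (x ≺ f b) → ∃ λ a → f a ≡ x
      <-preserved : ∀ {a b} → toℕ a < toℕ b → rank (f a) < rank (f b)
      <-reflected : ∀ {a b} → rank (f a) < rank (f b) → toℕ a < toℕ b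
      label-preserved : ∀ {a b} → T (R a b) → π a b ≡ label (f a) (f b)

  module _ {m} {R : Order (suc m)} {π} {f} (E : Embeds R π f) where
    open Embeds E

    immediate-image : ∀ {a b} → ImmPred R a b → ImmNode (f a) (f b)
    immediate-image {a} {b} (a≺b , none) = ≺-preserved a≺b , between
      where
        between : ∀ z → T (f a ≺ z) → ¬ T (z ≺ f b)
        between z fa≺z z≺fb with downward-closed {z} z≺fb
        ... | c , refl = none c (≺-reflected fa≺z) (≺-reflected z≺fb)

    immediate-preimage : ∀ {a b} → ImmNode (f a) (f b) → ImmPred R a b
    immediate-preimage (fa≺fb , none) =
      ≺-reflected fa≺fb , λ c a≺c c≺b → none (f c) (≺-preserved a≺c) (≺-preserved c≺b)

    module _ (tree : IsTreeOrd R) where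

      ≺-rank-below : ∀ {x} b → T (x ≺ f b) → rank x < rank (f b)
      ≺-rank-below {x} b x≺fb with downward-closed {x} x≺fb
      ... | a , refl = <-preserved (proj₁ tree a b (≺-reflected x≺fb))

      ≺-trans-below : ∀ {x y} c → T (x ≺ y) → T (y ≺ f c) → T (x ≺ f c)
      ≺-trans-below {x} {y} c x≺y y≺fc with downward-closed {y} y≺fc
      ... | b , refl with downward-closed {x} x≺y
      ...   | a , refl =
        ≺-preserved (proj₁ (proj₂ tree) a b c (≺-reflected x≺y) (≺-reflected y≺fc))

      ≺-linear-below : ∀ {x x'} b → T (x ≺ f b) → T (x' ≺ f b) →
                       T (x ≺ x') ⊎ x ≡ x' ⊎ T (x' ≺ x)
      ≺-linear-below {x} {x'} b x≺fb x'≺fb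
        with downward-closed {x} x≺fb | downward-closed {x'} x'≺fb
      ... | a , refl | a' , refl =
        Sum.map ≺-preserved (Sum.map (cong f) ≺-preserved)
          (proj₂ (proj₂ tree) a a' b (≺-reflected x≺fb) (≺-reflected x'≺fb))

  inj₁-embeds : Embeds R₁ π₁ inj₁
  inj₁-embeds = record
    { root = refl
    ; injective = inj₁-injective
    ; ≺-preserved = id
    ; ≺-reflected = id
    ; downward-closed = λ { {inj₁ k} _ → k , refl ; {inj₂ l} () }
    ; <-preserved = id
    ; <-reflected = id
    ; label-preserved = λ _ → refl
    }

  toNode : Fin (suc (m₁ + m₂)) → Node
  toNode = splitAt (suc m₁)

  fromNode : Node → Fin (suc (m₁ + m₂))
  fromNode = join (suc m₁) m₂

  toNode-fromNode : ∀ x → toNode (fromNode x) ≡ x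
  toNode-fromNode = splitAt-join (suc m₁) m₂

  fromNode-injective : ∀ {x y} → fromNode x ≡ fromNode y → x ≡ y
  fromNode-injective {x} {y} e =
    trans (sym (toNode-fromNode x)) (trans (cong toNode e) (toNode-fromNode y))

  toNode-injective : ∀ {a b} → toNode a ≡ toNode b → a ≡ b
  toNode-injective {a} {b} e =
    trans (sym (join-splitAt (suc m₁) m₂ a)) (trans (cong fromNode e) (join-splitAt (suc m₁) m₂ b))

  toℕ-fromNode : ∀ x → toℕ (fromNode x) ≡ rank x
  toℕ-fromNode (inj₁ k) = toℕ-↑ˡ k m₂
  toℕ-fromNode (inj₂ l) = toℕ-↑ʳ (suc m₁) l

  rank-toNode : ∀ a → rank (toNode a) ≡ toℕ a
  rank-toNode a = trans (sym (toℕ-fromNode (toNode a))) (cong toℕ (join-splitAt (suc m₁) m₂ a))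

  merged : Order (suc (m₁ + m₂))
  merged a b = toNode a ≺ toNode b

  mergedLabels : Labels (suc (m₁ + m₂))
  mergedLabels a b = label (toNode a) (toNode b)

  merged-fromNode : ∀ x y → merged (fromNode x) (fromNode y) ≡ x ≺ y
  merged-fromNode x y = cong₂ _≺_ (toNode-fromNode x) (toNode-fromNode y)

  immediate-toNode : ∀ {a b} → ImmPred merged a b → ImmNode (toNode a) (toNode b)
  immediate-toNode {a} {b} (a≺b , none) = a≺b , λ z a≺z z≺b →
    none (fromNode z) (subst (λ u → T (toNode a ≺ u)) (sym (toNode-fromNode z)) a≺z)
                      (subst (λ u → T (u ≺ toNode b)) (sym (toNode-fromNode z)) z≺b)

  immediate-fromNode : ∀ {x y} → ImmNode x y → ImmPred merged (fromNode x) (fromNode y)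
  immediate-fromNode {x} {y} (x≺y , none) =
    subst T (sym (merged-fromNode x y)) x≺y , λ c x≺c c≺y →
    none (toNode c) (subst (λ u → T (u ≺ toNode c)) (toNode-fromNode x) x≺c)
                    (subst (λ u → T (toNode c ≺ u)) (toNode-fromNode y) c≺y)

  toTreeEmbedding : ∀ {m} {R : Order (suc m)} {π} {f} → Embeds R π f →
                    TreeEmbedding R π merged mergedLabels
  toTreeEmbedding {f = f} E = record
    { embed = fromNode ∘ f
    ; embed-fzero = cong fromNode root
    ; embed-injective = injective ∘ fromNode-injective
    ; embed-reflects-< = λ {a} {b} →
        <-reflected ∘ subst₂ _<_ (toℕ-fromNode (f a)) (toℕ-fromNode (f b))
    ; ≺-preserved = λ {a} {b} → subst T (sym (merged-fromNode (f a) (f b))) ∘ ≺-preserved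
    ; ≺-reflected = λ {a} {b} → ≺-reflected ∘ subst T (merged-fromNode (f a) (f b))
    ; immediate-preserved = λ {a} {b} imm → immediate-fromNode {f a} {f b} (immediate-image E imm)
    ; label-preserved = λ {a} {b} imm →
        trans (label-preserved (proj₁ imm))
              (sym (cong₂ label (toNode-fromNode (f a)) (toNode-fromNode (f b))))
    }
    where open Embeds E

  _⋈_ : ∀ {A : Set} → (Fin (suc m₁) → A) → (Fin (suc m₂) → A) →
        Fin (suc (m₁ + m₂)) → A
  (g ⋈ h) a = [ g , h ∘ fsuc ]′ (toNode a)

  ⋈-all : ∀ {A : Set} (Q : A → Set) g h → (∀ k → Q (g k)) → (∀ k → Q (h k)) →
          ∀ a → Q ((g ⋈ h) a)
  ⋈-all Q g h Qg Qh a = [_,_] {C = λ x → Q ([ g , h ∘ fsuc ]′ x)} Qg (Qh ∘ fsuc) (toNode a)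

  ⋈-left : ∀ {A : Set} (g : Fin (suc m₁) → A) h k → (g ⋈ h) (fromNode (inj₁ k)) ≡ g k
  ⋈-left g h k = cong [ g , h ∘ fsuc ]′ (toNode-fromNode (inj₁ k))

  ⋈-right : ∀ {A : Set} (g : Fin (suc m₁) → A) h → g fzero ≡ h fzero →
            ∀ k → (g ⋈ h) (fromNode (right k)) ≡ h k
  ⋈-right g h g0≡h0 fzero    = g0≡h0
  ⋈-right g h _     (fsuc l) = cong [ g , h ∘ fsuc ]′ (toNode-fromNode (inj₂ l))

  leftEmbedding : TreeEmbedding R₁ π₁ merged mergedLabels
  leftEmbedding = toTreeEmbedding inj₁-embeds

  module _ (tree₁ : IsTreeOrd R₁) (tree₂ : IsTreeOrd R₂) where
    open TreeOrd tree₁ renaming (≺-irrefl to ≺₁-irrefl; ≺-fzero to ≺₁-fzero)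
    open TreeOrd tree₂ renaming (≺-irrefl to ≺₂-irrefl; ≺-fzero to ≺₂-fzero)

    right-embeds : Embeds R₂ π₂ right
    right-embeds = record
      { root = refl
      ; injective = injective
      ; ≺-preserved = preserved
      ; ≺-reflected = reflected
      ; downward-closed = downward-closed
      ; <-preserved = <-preserved
      ; <-reflected = <-reflected
      ; label-preserved = label-preserved
      }
      where
        injective : ∀ {a b} → right a ≡ right b → a ≡ b
        injective {fzero}  {fzero}  _    = refl
        injective {fsuc k} {fsuc l} refl = refl
        injective {fzero}  {fsuc l} ()
        injective {fsuc k} {fzero}  ()

        preserved : ∀ {a b} → T (R₂ a b) → T (right a ≺ right b)
        preserved {fzero}  {fzero}  r = ⊥-elim (≺₂-irrefl fzero r)
        preserved {fzero}  {fsuc l} r = r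
        preserved {fsuc k} {fzero}  r = ⊥-elim (≺₂-fzero (fsuc k) r)
        preserved {fsuc k} {fsuc l} r = r

        reflected : ∀ {a b} → T (right a ≺ right b) → T (R₂ a b)
        reflected {fzero}  {fzero}  r = ⊥-elim (≺₁-irrefl fzero r)
        reflected {fzero}  {fsuc l} r = r
        reflected {fsuc k} {fzero}  ()
        reflected {fsuc k} {fsuc l} r = r

        downward-closed : ∀ {x b} → T (x ≺ right b) → ∃ λ a → right a ≡ x
        downward-closed {inj₁ k}        {fzero}  r = ⊥-elim (≺₁-fzero k r)
        downward-closed {inj₂ l}        {fzero}  ()
        downward-closed {inj₁ fzero}    {fsuc l} _ = fzero , refl
        downward-closed {inj₁ (fsuc k)} {fsuc l} ()
        downward-closed {inj₂ k}        {fsuc l} _ = fsuc k , refl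

        <-preserved : ∀ {a b} → toℕ a < toℕ b → rank (right a) < rank (right b)
        <-preserved {fzero}  {fsuc l} _         = s≤s z≤n
        <-preserved {fsuc k} {fsuc l} (s≤s k<l) = s≤s (ℕ.+-monoʳ-< m₁ k<l)

        <-reflected : ∀ {a b} → rank (right a) < rank (right b) → toℕ a < toℕ b
        <-reflected {fzero}  {fsuc l} _ = s≤s z≤n
        <-reflected {fsuc k} {fsuc l} (s≤s k<l) = s≤s (ℕ.+-cancelˡ-< m₁ _ _ k<l)

        label-preserved : ∀ {a b} → T (R₂ a b) → π₂ a b ≡ label (right a) (right b)
        label-preserved {fzero}  {fzero}  r = ⊥-elim (≺₂-irrefl fzero r)
        label-preserved {fzero}  {fsuc l} _ = refl
        label-preserved {fsuc k} {fzero}  r = ⊥-elim (≺₂-fzero (fsuc k) r)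
        label-preserved {fsuc k} {fsuc l} _ = refl

    ≺-rank : ∀ x y → T (x ≺ y) → rank x < rank y
    ≺-rank x (inj₁ l) = ≺-rank-below inj₁-embeds tree₁ {x} l
    ≺-rank x (inj₂ l) = ≺-rank-below right-embeds tree₂ {x} (fsuc l)

    ≺-trans : ∀ x y z → T (x ≺ y) → T (y ≺ z) → T (x ≺ z)
    ≺-trans x y (inj₁ l) = ≺-trans-below inj₁-embeds tree₁ {x} {y} l
    ≺-trans x y (inj₂ l) = ≺-trans-below right-embeds tree₂ {x} {y} (fsuc l)

    ≺-linear : ∀ x x' y → T (x ≺ y) → T (x' ≺ y) → T (x ≺ x') ⊎ x ≡ x' ⊎ T (x' ≺ x)
    ≺-linear x x' (inj₁ l) = ≺-linear-below inj₁-embeds tree₁ {x} {x'} l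
    ≺-linear x x' (inj₂ l) = ≺-linear-below right-embeds tree₂ {x} {x'} (fsuc l)

    merged-isTreeOrd : IsTreeOrd merged
    merged-isTreeOrd =
      (λ a b a≺b →
        subst₂ _<_ (rank-toNode a) (rank-toNode b) (≺-rank (toNode a) (toNode b) a≺b)) ,
      (λ a b c → ≺-trans (toNode a) (toNode b) (toNode c)) ,
      λ a a' b a≺b a'≺b →
        Sum.map id (Sum.map (λ e → toNode-injective {a} {a'} e) id)
          (≺-linear (toNode a) (toNode a') (toNode b) a≺b a'≺b)

    rightEmbedding : TreeEmbedding R₂ π₂ merged mergedLabels
    rightEmbedding = toTreeEmbedding right-embeds

module Basis (ns : ℕ → ℕ) (ns-increasing : ∀ i → ns i < ns (suc i))
             (C : (i : ℕ) → Block ns i → Set) (P : ℕ → Cantor → Set) where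
  open Setup ns C P

  tuple : (m : ℕ) → Order (suc m) → Labels (suc m) → ℕ → (Fin (suc m) → Cantor) → Tuple
  tuple m R π i s = record { m = m ; prec = R ; π = π ; i = i ; s = s }

  ns-monotone′ : ∀ {i j} → i ≤′ j → ns i ≤ ns j
  ns-monotone′ ≤′-refl         = ℕ.≤-refl
  ns-monotone′ (≤′-step i≤′j) =
    ℕ.≤-trans (ns-monotone′ i≤′j) (ℕ.<⇒≤ (ns-increasing _))

  ns-monotone : ∀ {i j} → i ≤ j → ns i ≤ ns j
  ns-monotone = ns-monotone′ ∘ ℕ.≤⇒≤′

  i≤ns : ∀ i → i ≤ ns i
  i≤ns zero    = z≤n
  i≤ns (suc i) = ℕ.≤-trans (s≤s (i≤ns i)) (ns-increasing i)

  block-index< : ∀ {j' j} (t : Fin (len ns j')) → j' < j → ns j' + toℕ t < ns j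
  block-index< {j'} {j} t j'<j = begin-strict
    ns j' + toℕ t      <⟨ ℕ.+-monoʳ-< (ns j') (toℕ<n t) ⟩
    ns j' + len ns j'  ≡⟨ ℕ.m+[n∸m]≡n (ℕ.<⇒≤ (ns-increasing j')) ⟩
    ns (suc j')        ≤⟨ ns-monotone j'<j ⟩
    ns j               ∎
    where open ℕ.≤-Reasoning

  Acceptable-resp : ∀ {j u v} → AgreeBelow (ns j) u v → Acceptable j u → Acceptable j v
  Acceptable-resp u≈v u-acc j' j'<j =
    subst (C j') (tabulate-cong λ t → u≈v _ (block-index< t j'<j)) (u-acc j' j'<j)

  TStar-resp : ∀ {p d u v} → AgreeBelow d u v → TStar p u d → TStar p v d
  TStar-resp u≈v (z , z∈P+P , u≈z) = z , z∈P+P , AgreeBelow-trans (AgreeBelow-sym u≈v) u≈z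

  module _ {m' m} {R' : Order (suc m')} {π'} {R : Order (suc m)} {π}
           (E : TreeEmbedding R' π' R π) where
    open TreeEmbedding E

    InS-pullback : ∀ {j s s'} → (∀ k → AgreeBelow (ns j) (s (embed k)) (s' k)) →
                   InS (tuple m R π j s) → InS (tuple m' R' π' j s')
    InS-pullback agree (tree , size , acceptable , sums) =
      isTreeOrd-pullback E tree ,
      ℕ.≤-trans (injective⇒≤ embed-injective) size ,
      (λ k → Acceptable-resp (agree k) (acceptable (embed k))) ,
      λ a b imm → subst (λ p → TStar p _ _) (sym (label-preserved imm))
        (TStar-resp (AgreeBelow-⊕ (agree a) (agree b)) (sums _ _ (immediate-preserved imm)))

    U-pullback : ∀ {i s s' y} → (∀ k → AgreeBelow (ns i) (s (embed k)) (s' k)) →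
                 U (tuple m R π i s) y → U (tuple m' R' π' i s') y
    U-pullback {y = y} agree (y∈H , zs , zs∈H , zs-agree , zs∈S) =
      y∈H , ys , (λ k → subst InH (full-embed k) (zs∈H (embed k))) ,
      (λ k → AgreeBelow-trans (AgreeBelow-sym (agree k))
               (AgreeBelow-trans (zs-agree (embed k)) (≡⇒AgreeBelow (full-embed k)))) ,
      λ j i<j → InS-pullback {s = full y zs} (λ k → ≡⇒AgreeBelow (full-embed k)) (zs∈S j i<j)
      where
        ys : Fin m' → Cantor
        ys k = full y zs (embed (fsuc k))
        full-embed : ∀ k → full y zs (embed k) ≡ full y ys k
        full-embed fzero    = cong (full y zs) embed-fzero
        full-embed (fsuc k) = refl

  InS-agree : ∀ {m R π j} {s s' : Fin (suc m) → Cantor} →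
              (∀ k → AgreeBelow (ns j) (s k) (s' k)) →
              InS (tuple m R π j s) → InS (tuple m R π j s')
  InS-agree = InS-pullback (≗-embedding (λ _ _ → refl) (λ _ _ → refl))

  U-cong : ∀ {m i} {R R' : Order (suc m)} {π π' : Labels (suc m)} {s s' y} →
    (∀ a b → R a b ≡ R' a b) → (∀ a b → π a b ≡ π' a b) →
    (∀ k → AgreeBelow (ns i) (s k) (s' k)) →
    U (tuple m R π i s) y → U (tuple m R' π' i s') y
  U-cong R≗R' π≗π' = U-pullback (≗-embedding R≗R' π≗π')

  U-raise : ∀ {m R π i I s x₀} (xs : Fin m → Cantor) → i ≤ I →
    (∀ k → AgreeBelow (ns i) (s k) (full x₀ xs k)) →
    (∀ j → i < j → InS (tuple m R π j (full x₀ xs))) →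
    ∀ {y} → U (tuple m R π I (full x₀ xs)) y → U (tuple m R π i s) y
  U-raise {m} {R} {π} {i} {I} xs i≤I xs-agree xs∈S (y∈H , ys , ys∈H , ys-agree , ys∈S) =
    y∈H , ys , ys∈H ,
    (λ k → AgreeBelow-trans (xs-agree k) (AgreeBelow-weaken (ns-monotone i≤I) (ys-agree k))) ,
    later
    where
      later : ∀ j → i < j → InS (tuple m R π j (full _ ys))
      later j i<j with j ≤? I
      ... | yes j≤I =
        InS-agree (λ k → AgreeBelow-weaken (ns-monotone j≤I) (ys-agree k)) (xs∈S j i<j)
      ... | no  j≰I = ys∈S j (ℕ.≰⇒> j≰I)

  U-self : ∀ {m R π i} {t : Fin (suc m) → Cantor} → (∀ k → InH (t k)) →
           (∀ j → i < j → InS (tuple m R π j t)) → U (tuple m R π i t) (t fzero)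
  U-self {t = t} t∈H t∈S =
    t∈H fzero , t ∘ fsuc , (λ k → subst InH (sym (full-split k)) (t∈H k)) ,
    (λ k → ≡⇒AgreeBelow (sym (full-split k))) ,
    λ j i<j → InS-agree (λ k → ≡⇒AgreeBelow (sym (full-split k))) (t∈S j i<j)
    where
      full-split : ∀ k → full (t fzero) (t ∘ fsuc) k ≡ t k
      full-split fzero    = refl
      full-split (fsuc k) = refl

  module _ {m₁ m₂} {R₁ : Order (suc m₁)} {R₂ : Order (suc m₂)}
           {π₁ : Labels (suc m₁)} {π₂ : Labels (suc m₂)} where
    open Merge R₁ R₂ π₁ π₂

    InS-merge : ∀ {j s₁ s₂} → s₁ fzero ≡ s₂ fzero → suc (m₁ + m₂) ≤ ns j →
      InS (tuple m₁ R₁ π₁ j s₁) → InS (tuple m₂ R₂ π₂ j s₂) →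
      InS (tuple (m₁ + m₂) merged mergedLabels j (s₁ ⋈ s₂))
    InS-merge {j} {s₁} {s₂} root size
              (tree₁ , _ , acc₁ , sums₁) (tree₂ , _ , acc₂ , sums₂) =
      merged-isTreeOrd tree₁ tree₂ , size , ⋈-all (Acceptable j) s₁ s₂ acc₁ acc₂ ,
      λ a b imm → sums (toNode a) (toNode b) (immediate-toNode {a} {b} imm)
      where
        s : Node → Cantor
        s = [ s₁ , s₂ ∘ fsuc ]′

        left-preimage : ∀ {k l} → ImmNode (inj₁ k) (inj₁ l) → ImmPred R₁ k l
        left-preimage = immediate-preimage inj₁-embeds

        right-preimage : ∀ {k l} → ImmNode (right k) (right l) → ImmPred R₂ k l
        right-preimage = immediate-preimage (right-embeds tree₁ tree₂)

        sums : ∀ x y → ImmNode x y → TStar (label x y) (s x ⊕ s y) (ns j)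
        sums (inj₁ k)        (inj₁ l) imm = sums₁ k l (left-preimage imm)
        sums (inj₁ fzero)    (inj₂ l) imm =
          subst (λ z → TStar _ (z ⊕ s₂ (fsuc l)) (ns j)) (sym root)
            (sums₂ fzero (fsuc l) (right-preimage imm))
        sums (inj₁ (fsuc k)) (inj₂ l) (() , _)
        sums (inj₂ k)        (inj₁ l) (() , _)
        sums (inj₂ k)        (inj₂ l) imm = sums₂ (fsuc k) (fsuc l) (right-preimage imm)

  refine : ∀ ρ₁ ρ₂ → InS ρ₁ → InS ρ₂ → ∀ x₀ → U ρ₁ x₀ → U ρ₂ x₀ →
           Σ Tuple λ ρ → InS ρ × U ρ x₀ × (∀ y → U ρ y → U ρ₁ y × U ρ₂ y)
  refine (record { m = m₁ ; prec = R₁ ; π = π₁ ; i = i₁ ; s = s₁ })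
         (record { m = m₂ ; prec = R₂ ; π = π₂ ; i = i₂ ; s = s₂ })
         (tree₁ , size₁ , _) (tree₂ , size₂ , _) x₀
         (x₀∈H , xs₁ , xs₁∈H , agree₁ , later₁)
         (_    , xs₂ , xs₂∈H , agree₂ , later₂) =
    tuple (m₁ + m₂) merged mergedLabels I t , t∈S I ℕ.≤-refl ,
    U-self (⋈-all InH t₁ t₂ xs₁∈H xs₂∈H) (λ j I<j → t∈S j (ℕ.<⇒≤ I<j)) ,
    λ y y∈U →
      U-raise xs₁ (ℕ.<⇒≤ i₁<I) agree₁ later₁
        (U-pullback leftEmbedding (λ k → ≡⇒AgreeBelow (⋈-left t₁ t₂ k)) y∈U) ,
      U-raise xs₂ (ℕ.<⇒≤ i₂<I) agree₂ later₂
        (U-pullback (rightEmbedding tree₁ tree₂)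
          (λ k → ≡⇒AgreeBelow (⋈-right t₁ t₂ refl k)) y∈U)
    where
      open Merge R₁ R₂ π₁ π₂
      open ℕ.≤-Reasoning

      t₁ : Fin (suc m₁) → Cantor
      t₁ = full x₀ xs₁

      t₂ : Fin (suc m₂) → Cantor
      t₂ = full x₀ xs₂

      t : Fin (suc (m₁ + m₂)) → Cantor
      t = t₁ ⋈ t₂

      I : ℕ
      I = suc (ns i₁ + ns i₂)

      i₁<I : i₁ < I
      i₁<I = s≤s (ℕ.≤-trans (i≤ns i₁) (ℕ.m≤m+n (ns i₁) (ns i₂)))

      i₂<I : i₂ < I
      i₂<I = s≤s (ℕ.≤-trans (i≤ns i₂) (ℕ.m≤n+m (ns i₂) (ns i₁)))

      nodes≤ns : ∀ {j} → I ≤ j → suc (m₁ + m₂) ≤ ns j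
      nodes≤ns {j} I≤j = begin
        suc m₁ + m₂    ≤⟨ ℕ.+-mono-≤ size₁ (ℕ.≤-trans (ℕ.n≤1+n m₂) size₂) ⟩
        ns i₁ + ns i₂  <⟨ ℕ.≤-refl ⟩
        I              ≤⟨ i≤ns I ⟩
        ns I           ≤⟨ ns-monotone I≤j ⟩
        ns j           ∎

      t∈S : ∀ j → I ≤ j → InS (tuple (m₁ + m₂) merged mergedLabels j t)
      t∈S j I≤j = InS-merge {s₁ = t₁} {t₂} refl (nodes≤ns I≤j)
        (later₁ j (ℕ.<-≤-trans i₁<I I≤j)) (later₂ j (ℕ.<-≤-trans i₂<I I≤j))

  cover : ∀ x → InH x → Σ Tuple λ ρ → InS ρ × U ρ x
  cover x x∈H =
    singleton 1 , singleton∈S 1 ℕ.≤-refl ,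
    U-self (λ _ → x∈H) (λ j 1<j → singleton∈S j (ℕ.<⇒≤ 1<j))
    where
      singleton : ℕ → Tuple
      singleton j = tuple 0 (λ _ _ → false) (λ _ _ → 0) j (λ _ → x)
      singleton∈S : ∀ j → 1 ≤ j → InS (singleton j)
      singleton∈S j 1≤j =
        ((λ _ _ ()) , (λ _ _ _ ()) , (λ _ _ _ ())) , ℕ.≤-trans 1≤j (i≤ns j) ,
        (λ _ j' _ → x∈H j') , λ { _ _ (() , _) }

  encodeOrder : ∀ m → Order (suc m) → ℕᵇ → ℕᵇ
  encodeOrder m R = encodeFin (suc m) λ k → encodeFin (suc m) λ l → R k l ∷𝔹_

  encodeLabels : ∀ m → Labels (suc m) → ℕᵇ → ℕᵇ
  encodeLabels m π = encodeFin (suc m) λ k → encodeFin (suc m) λ l → π k l ∷ℕ_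

  encodeSequences : ∀ m i → (Fin (suc m) → Cantor) → ℕᵇ → ℕᵇ
  encodeSequences m i s = encodeFin (suc m) λ k → encodeFin (ns i) λ t → s k (toℕ t) ∷𝔹_

  encode : Tuple → ℕᵇ
  encode ρ = m ∷ℕ i ∷ℕ encodeOrder m prec (encodeLabels m π (encodeSequences m i s ℕᵇ.zero))
    where open Tuple ρ

  code : Σ Tuple InS → ℕ
  code (ρ , _) = ℕᵇ.toℕ (encode ρ)

  code-determines-U : ∀ ρ ρ' → code ρ ≡ code ρ' → SetEq (U (proj₁ ρ)) (U (proj₁ ρ'))
  code-determines-U (ρ@(record { m = m ; prec = R ; π = π ; i = i ; s = s }) , _)
                    (ρ'@(record { m = m' ; prec = R' ; π = π' ; i = i' ; s = s' }) , _) eq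
    with ∷ℕ-injective {m} {m'} (toℕ-injective {encode ρ} {encode ρ'} eq)
  ... | refl , eq₁ with ∷ℕ-injective {i} {i'} eq₁
  ... | refl , eq₂
    with encodeFin-injective (suc m) _ (λ _ → encodeFin-injective (suc m) _ λ _ → ∷𝔹-injective)
           {encodeLabels m π _} {encodeLabels m π' _} eq₂
  ... | R≗R' , eq₃
    with encodeFin-injective (suc m) _ (λ _ → encodeFin-injective (suc m) _ λ _ → ∷ℕ-injective)
           {encodeSequences m i s _} {encodeSequences m i s' _} eq₃
  ... | π≗π' , eq₄
    with encodeFin-injective (suc m) _ (λ _ → encodeFin-injective (ns i) _ λ _ → ∷𝔹-injective)
           {ℕᵇ.zero} {ℕᵇ.zero} eq₄
  ... | s≗s' , _ = λ y →
    U-cong R≗R' π≗π' (λ k → AgreeBelow-fromFin (s≗s' k)) ,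
    U-cong (λ a b → sym (R≗R' a b)) (λ a b → sym (π≗π' a b))
           (λ k → AgreeBelow-fromFin (sym ∘ s≗s' k))

proposition2p4 : (ns : ℕ → ℕ) → ns 0 ≡ 0 → (∀ i → ns i < ns (suc i)) →
    (C : (i : ℕ) → Block ns i → Set) → CHyp ns C →
    (P : ℕ → Cantor → Set) → (∀ m → Perfect (P m)) →
    let open Setup ns C P in
    (∀ ρ₁ ρ₂ → InS ρ₁ → InS ρ₂ → ∀ x₀ → U ρ₁ x₀ → U ρ₂ x₀ →
      Σ Tuple λ ρ → InS ρ × U ρ x₀ × (∀ y → U ρ y → U ρ₁ y × U ρ₂ y))
    × (∀ x → InH x → Σ Tuple λ ρ → InS ρ × U ρ x)
    × (Σ (Σ Tuple InS → ℕ) λ f →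
        ∀ ρ ρ' → f ρ ≡ f ρ' → SetEq (U (proj₁ ρ)) (U (proj₁ ρ')))
proposition2p4 ns _ ns-increasing C _ P _ = refine , cover , code , code-determines-U
  where open Basis ns ns-increasing C P
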